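{- Let $n\geq k\geq 1$ and let $S\neq T$ be $k$-subsets of $[n]$. Then the multigraph $h(S,T)$ contains no cycle with more than $2$ vertices.
   Context: $[m]=\{1,\dots,m\}$. For a $k$-subset $S$ of $[n]$ define $f(S)\subseteq([n]\setminus[k])\times[k]$: if $S=[k]$ then $f(S)=\emptyset$; otherwise let $S\setminus[k]=\{x_1,\dots,x_t\}$ with $n\geq x_1>\dots>x_t\geq k+1$ and $[k]\setminus S=\{y_1,\dots,y_t\}$ with $1\leq y_1<\dots<y_t\leq k$, and set $f(S)=\{(x_1,y_1),\dots,(x_t,y_t)\}$. Let $h(S)$ be the graph on $[n]$ whose edges are the pairs $\{x,y\}$ with $(x,y)\in f(S)$, and $h(S,T)$ the multigraph union of $h(S)$ and $h(T)$ (pairs in $f(S)\cap f(T)$ give double edges, i.e. cycles of length $2$). -}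

module Defs where

open import Data.Nat using (ℕ; _≤_; _<_; _≤?_; _<?_)
open import Data.Fin using (Fin; toℕ)
open import Data.Fin.Subset using (Subset; ∣_∣)
open import Relation.Binary.PropositionalEquality using (_≡_)
open import Data.Fin.Subset.Properties using (_∈?_)
open import Data.List using (List; []; _∷_; filter; reverse; zip; length; _++_; [_])
open import Data.List.Base using (allFin)
open import Data.List.Membership.Propositional using () renaming (_∈_ to _∈ₗ_)
open import Data.List.Relation.Unary.Unique.Propositional using (Unique)
open import Data.List.Relation.Unary.Linked using (Linked)
open import Data.Product using (_×_; _,_; ∃)
open import Data.Sum using (_⊎_)
open import Relation.Nullary.Decidable using (_×-dec_; ¬?)

-- Vertex i : Fin n represents the integer toℕ i + 1 ∈ [n].
-- Hence "i ∈ [k]" iff toℕ i < k, and "i ∈ [n] \ [k]" iff k ≤ toℕ i.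

xsOf : ∀ {n} (k : ℕ) → Subset n → List (Fin n)
xsOf {n} k S = filter (λ i → (k ≤? toℕ i) ×-dec (i ∈? S)) (reverse (allFin n))

ysOf : ∀ {n} (k : ℕ) → Subset n → List (Fin n)
ysOf {n} k S = filter (λ i → (toℕ i <? k) ×-dec ¬? (i ∈? S)) (allFin n)

f : ∀ {n} (k : ℕ) → Subset n → List (Fin n × Fin n)
f k S = zip (xsOf k S) (ysOf k S)

AdjH : ∀ {n} (k : ℕ) → Subset n → Fin n → Fin n → Set
AdjH k S u v = ((u , v) ∈ₗ f k S) ⊎ ((v , u) ∈ₗ f k S)

AdjHST : ∀ {n} (k : ℕ) → Subset n → Subset n → Fin n → Fin n → Set
AdjHST k S T u v = AdjH k S u v ⊎ AdjH k T u v

-- A cycle with more than 2 vertices in a graph with adjacency relation Adj: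
-- distinct vertices v, w_1, ..., w_m (m ≥ 2) with v ~ w_1 ~ ... ~ w_m ~ v.
-- (With ≥ 3 distinct vertices the consecutive edges are automatically distinct,
-- so edge multiplicities are irrelevant.)
HasLongCycle : ∀ {n} → (Fin n → Fin n → Set) → Set
HasLongCycle {n} Adj =
  ∃ λ (v : Fin n) → ∃ λ (ws : List (Fin n)) →
    (2 ≤ length ws) × Unique (v ∷ ws) × Linked Adj (v ∷ ws ++ [ v ])

IsKSubset : ∀ {n} (k : ℕ) → Subset n → Set
IsKSubset k S = ∣ S ∣ ≡ k

-- Each h(S) is a matching between [n] \ [k] and [k], and it is antitone: the
-- larger x_i, the smaller its partner y_i.  On a cycle with at least three
-- vertices in h(S) ∪ h(T) every vertex therefore has one S-neighbour and one
-- distinct T-neighbour on the cycle.  Let X be the largest vertex of the cycle;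
-- it lies above [k], with S-partner a and T-partner b.  Every small vertex y of
-- the cycle is the S-partner of some cycle vertex x ≤ X, so by antitonicity
-- a ≤ y; in particular a ≤ b, and symmetrically b ≤ a, contradicting a ≠ b.
module Submission where

open import Defs
open import Data.Nat using (ℕ; _≤_; _<_; s≤s; _≤?_)
open import Data.Nat.Properties
  using (≤-refl; ≤-trans; ≤-antisym; <⇒≤; <⇒≱; ≰⇒>; <-irrefl; ≤-totalOrder)
open import Data.Fin using (Fin; toℕ)
open import Data.Fin.Properties using (toℕ-injective)
open import Data.Fin.Subset using (Subset)
open import Relation.Binary.PropositionalEquality using (_≡_; _≢_; refl; sym; subst)
open import Relation.Nullary using (¬_; yes; no)
open import Function using (_∘_; id)
open import Data.Empty using (⊥; ⊥-elim)
open import Data.Product using (_×_; _,_; ∃; ∃₂; proj₁; proj₂)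
open import Data.Sum using (_⊎_; inj₁; inj₂)
open import Data.List using (List; []; _∷_; _++_; [_]; zip; reverse; length; allFin)
open import Data.List.Properties using (unfold-reverse; ++-assoc)
open import Data.List.Membership.Propositional using (_∈_)
open import Data.List.Membership.Propositional.Properties
  using (∈-∃++; ∈-filter⁻; ∈-++⁺ʳ; ∈-++⁺ˡ)
open import Data.List.Relation.Unary.Any using (here; there)
import Data.List.Relation.Unary.Any.Properties as Any
open import Data.List.Relation.Unary.All as All using ([]; _∷_)
open import Data.List.Relation.Unary.AllPairs using (AllPairs; []; _∷_)
import Data.List.Relation.Unary.AllPairs.Properties as AllPairs
open import Data.List.Relation.Unary.Linked as Linked using (Linked)
open import Data.List.Relation.Unary.Unique.Propositional using (Unique)
open import Data.List.Extrema ≤-totalOrder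
  using (argmax; argmax-sel; f[⊥]≤f[argmax]; f[xs]≤f[argmax])

module _ {A : Set} where

  lastOf : A → List A → A
  lastOf a []       = a
  lastOf a (x ∷ xs) = lastOf x xs

  lastOf-∈ : ∀ a xs → lastOf a xs ∈ a ∷ xs
  lastOf-∈ a []       = here refl
  lastOf-∈ a (x ∷ xs) = there (lastOf-∈ x xs)

  Unique-++⇒≢ : ∀ {xs ys : List A} {x y} → Unique (xs ++ ys) → x ∈ xs → y ∈ ys → x ≢ y
  Unique-++⇒≢ {xs = _ ∷ xs} (x∉ ∷ _) (here refl) y∈ = All.lookup x∉ (∈-++⁺ʳ xs y∈)
  Unique-++⇒≢ {xs = _ ∷ xs} (_ ∷ u)  (there x∈)  y∈ = Unique-++⇒≢ u x∈ y∈

  module _ {R : A → A → Set} where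

    Linked-infix : ∀ xs {a b ys} → Linked R (xs ++ a ∷ b ∷ ys) → R a b
    Linked-infix []       = Linked.head
    Linked-infix (_ ∷ xs) = Linked-infix xs ∘ Linked.tail

    Linked-lastOf : ∀ a xs {b ys} → Linked R ((a ∷ xs) ++ b ∷ ys) → R (lastOf a xs) b
    Linked-lastOf a []       = Linked.head
    Linked-lastOf a (x ∷ xs) = Linked-lastOf x xs ∘ Linked.tail

    AllPairs-reverse⁺ : ∀ {xs} → AllPairs R xs → AllPairs (λ a b → R b a) (reverse xs)
    AllPairs-reverse⁺ {[]}     []         = []
    AllPairs-reverse⁺ {x ∷ xs} (px ∷ pxs) rewrite unfold-reverse x xs =
      AllPairs.++⁺ (AllPairs-reverse⁺ pxs) ([] ∷ [])
        (All.tabulate (λ y∈ → All.lookup px (Any.reverse⁻ y∈) ∷ []))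

  argmax-∈ : ∀ (g : A → ℕ) v vs → argmax g v vs ∈ v ∷ vs
  argmax-∈ g v vs with argmax-sel g v vs
  ... | inj₁ X≡v = here X≡v
  ... | inj₂ X∈vs = there X∈vs

  argmax-maximal : ∀ (g : A → ℕ) v vs {u} → u ∈ v ∷ vs → g u ≤ g (argmax g v vs)
  argmax-maximal g v vs =
    All.lookup (f[⊥]≤f[argmax] {f = g} v vs ∷ f[xs]≤f[argmax] {f = g} v vs)

  TwoNeighbours : (A → A → Set) → List A → A → Set
  TwoNeighbours R C u = ∃₂ λ p q → p ∈ C × q ∈ C × p ≢ q × R u p × R u q

  module _ {R : A → A → Set} (R-sym : ∀ {x y} → R x y → R y x) where

    private
      interior-neighbours : ∀ {v} pre {u} post →
        Linked R (v ∷ pre ++ u ∷ post ++ [ v ]) → Unique (v ∷ pre ++ u ∷ post) →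
        2 ≤ length (pre ++ u ∷ post) → TwoNeighbours R (v ∷ pre ++ u ∷ post) u
      interior-neighbours {v} pre (c ∷ post) lk un _ =
        lastOf v pre , c , ∈-++⁺ˡ (lastOf-∈ v pre) , ∈-++⁺ʳ (v ∷ pre) (there (here refl)) ,
        Unique-++⇒≢ {xs = v ∷ pre} un (lastOf-∈ v pre) (there (here refl)) ,
        R-sym (Linked-lastOf v pre lk) , Linked-infix (v ∷ pre) lk
      interior-neighbours {v} (x ∷ pre) [] lk (v∉ ∷ _) _ =
        lastOf x pre , v , there (∈-++⁺ˡ (lastOf-∈ x pre)) , here refl ,
        (λ e → All.lookup v∉ (∈-++⁺ˡ (lastOf-∈ x pre)) (sym e)) ,
        R-sym (Linked-lastOf v (x ∷ pre) lk) , Linked-infix (v ∷ x ∷ pre) lk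
      interior-neighbours [] [] _ _ (s≤s ())

      endpoint-neighbours : ∀ v ws → Linked R (v ∷ ws ++ [ v ]) → Unique (v ∷ ws) →
        2 ≤ length ws → TwoNeighbours R (v ∷ ws) v
      endpoint-neighbours v (w₁ ∷ w₂ ∷ ws) lk (_ ∷ w₁∉ ∷ _) _ =
        w₁ , lastOf w₂ ws , there (here refl) , there (there (lastOf-∈ w₂ ws)) ,
        All.lookup w₁∉ (lastOf-∈ w₂ ws) ,
        Linked.head lk , R-sym (Linked-lastOf v (w₁ ∷ w₂ ∷ ws) lk)
      endpoint-neighbours v []       _ _ ()
      endpoint-neighbours v (_ ∷ []) _ _ (s≤s ())

    cycle-neighbours : ∀ v ws → Linked R (v ∷ ws ++ [ v ]) → Unique (v ∷ ws) → 2 ≤ length ws →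
                       ∀ {u} → u ∈ v ∷ ws → TwoNeighbours R (v ∷ ws) u
    cycle-neighbours v ws lk un len (here refl) = endpoint-neighbours v ws lk un len
    cycle-neighbours v ws lk un len (there u∈ws) with ∈-∃++ u∈ws
    ... | pre , post , refl =
      interior-neighbours pre post
        (subst (Linked R ∘ (v ∷_)) (++-assoc pre (_ ∷ post) [ v ]) lk) un len

module _ {A B : Set} where

  ∈-zip⁻ : ∀ {xs : List A} {ys : List B} {x y} → (x , y) ∈ zip xs ys → x ∈ xs × y ∈ ys
  ∈-zip⁻ {_ ∷ _} {_ ∷ _} (here refl) = here refl , here refl
  ∈-zip⁻ {_ ∷ _} {_ ∷ _} (there p)   = let x∈ , y∈ = ∈-zip⁻ p in there x∈ , there y∈

  ∈-zip-sorted : ∀ {R : A → A → Set} {Q : B → B → Set} {xs ys} →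
    AllPairs R xs → AllPairs Q ys → ∀ {x y x′ y′} →
    (x , y) ∈ zip xs ys → (x′ , y′) ∈ zip xs ys →
    (x ≡ x′ × y ≡ y′) ⊎ (R x x′ × Q y y′) ⊎ (R x′ x × Q y′ y)
  ∈-zip-sorted {xs = _ ∷ _} {_ ∷ _} _ _ (here refl) (here refl) = inj₁ (refl , refl)
  ∈-zip-sorted {xs = _ ∷ _} {_ ∷ _} (Rx ∷ _) (Qy ∷ _) (here refl) (there p′) =
    let x′∈ , y′∈ = ∈-zip⁻ p′ in inj₂ (inj₁ (All.lookup Rx x′∈ , All.lookup Qy y′∈))
  ∈-zip-sorted {xs = _ ∷ _} {_ ∷ _} (Rx ∷ _) (Qy ∷ _) (there p) (here refl) =
    let x∈ , y∈ = ∈-zip⁻ p in inj₂ (inj₂ (All.lookup Rx x∈ , All.lookup Qy y∈))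
  ∈-zip-sorted {xs = _ ∷ _} {_ ∷ _} (_ ∷ Rxs) (_ ∷ Qys) (there p) (there p′) =
    ∈-zip-sorted Rxs Qys p p′

module Matching {n : ℕ} (k : ℕ) (S : Subset n) where

  xsOf-decreasing : AllPairs (λ x x′ → toℕ x′ < toℕ x) (xsOf k S)
  xsOf-decreasing = AllPairs.filter⁺ _ (AllPairs-reverse⁺ (AllPairs.tabulate⁺-< id))

  ysOf-increasing : AllPairs (λ y y′ → toℕ y < toℕ y′) (ysOf k S)
  ysOf-increasing = AllPairs.filter⁺ _ (AllPairs.tabulate⁺-< id)

  f-sorted : ∀ {x y x′ y′} → (x , y) ∈ f k S → (x′ , y′) ∈ f k S →
    (x ≡ x′ × y ≡ y′) ⊎ (toℕ x′ < toℕ x × toℕ y < toℕ y′) ⊎ (toℕ x < toℕ x′ × toℕ y′ < toℕ y)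
  f-sorted = ∈-zip-sorted xsOf-decreasing ysOf-increasing

  f-fst-large : ∀ {x y} → (x , y) ∈ f k S → k ≤ toℕ x
  f-fst-large e = proj₁ (proj₂ (∈-filter⁻ _ {xs = reverse (allFin n)} (proj₁ (∈-zip⁻ e))))

  f-snd-small : ∀ {x y} → (x , y) ∈ f k S → toℕ y < k
  f-snd-small e = proj₁ (proj₂ (∈-filter⁻ _ {xs = allFin n} (proj₂ (∈-zip⁻ e))))

  f-antitone : ∀ {x y x′ y′} → (x , y) ∈ f k S → (x′ , y′) ∈ f k S →
               toℕ x′ ≤ toℕ x → toℕ y ≤ toℕ y′
  f-antitone e e′ x′≤x with f-sorted e e′
  ... | inj₁ (_ , refl)        = ≤-refl
  ... | inj₂ (inj₁ (_ , y<y′)) = <⇒≤ y<y′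
  ... | inj₂ (inj₂ (x<x′ , _)) = ⊥-elim (<⇒≱ x<x′ x′≤x)

  f-functional : ∀ {x y y′} → (x , y) ∈ f k S → (x , y′) ∈ f k S → y ≡ y′
  f-functional e e′ with f-sorted e e′
  ... | inj₁ (_ , y≡y′)        = y≡y′
  ... | inj₂ (inj₁ (x<x , _))  = ⊥-elim (<-irrefl refl x<x)
  ... | inj₂ (inj₂ (x<x , _))  = ⊥-elim (<-irrefl refl x<x)

  f-injective : ∀ {x x′ y} → (x , y) ∈ f k S → (x′ , y) ∈ f k S → x ≡ x′
  f-injective e e′ with f-sorted e e′
  ... | inj₁ (x≡x′ , _)        = x≡x′
  ... | inj₂ (inj₁ (_ , y<y))  = ⊥-elim (<-irrefl refl y<y)
  ... | inj₂ (inj₂ (_ , y<y))  = ⊥-elim (<-irrefl refl y<y)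

  AdjH-large : ∀ {u p} → k ≤ toℕ u → AdjH k S u p → (u , p) ∈ f k S
  AdjH-large _   (inj₁ e) = e
  AdjH-large k≤u (inj₂ e) = ⊥-elim (<⇒≱ (f-snd-small e) k≤u)

  AdjH-small : ∀ {u p} → toℕ u < k → AdjH k S u p → (p , u) ∈ f k S
  AdjH-small u<k (inj₁ e) = ⊥-elim (<⇒≱ u<k (f-fst-large e))
  AdjH-small _   (inj₂ e) = e

  AdjH-functional : ∀ {u p q} → AdjH k S u p → AdjH k S u q → p ≡ q
  AdjH-functional {u} up uq with k ≤? toℕ u
  ... | yes k≤u = f-functional (AdjH-large k≤u up) (AdjH-large k≤u uq)
  ... | no  k≰u = f-injective (AdjH-small (≰⇒> k≰u) up) (AdjH-small (≰⇒> k≰u) uq)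

  max-partner-least : ∀ {C : List (Fin n)} {X a} → (∀ {u} → u ∈ C → toℕ u ≤ toℕ X) →
    (∀ {y} → y ∈ C → ∃ λ x → x ∈ C × AdjH k S y x) →
    (X , a) ∈ f k S → ∀ {y} → y ∈ C → toℕ y < k → toℕ a ≤ toℕ y
  max-partner-least X-max partner X,a y∈C y<k =
    let x , x∈C , yx = partner y∈C in f-antitone X,a (AdjH-small y<k yx) (X-max x∈C)

  AdjH-max-large : ∀ {u p} → AdjH k S u p → toℕ p ≤ toℕ u → k ≤ toℕ u
  AdjH-max-large (inj₁ e) _   = f-fst-large e
  AdjH-max-large (inj₂ e) p≤u = ≤-trans (f-fst-large e) p≤u

module _ {n : ℕ} (k : ℕ) (S T : Subset n) where

  private
    module MS = Matching k S
    module MT = Matching k T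

  AdjHST-sym : ∀ {x y} → AdjHST k S T x y → AdjHST k S T y x
  AdjHST-sym (inj₁ (inj₁ e)) = inj₁ (inj₂ e)
  AdjHST-sym (inj₁ (inj₂ e)) = inj₁ (inj₁ e)
  AdjHST-sym (inj₂ (inj₁ e)) = inj₂ (inj₂ e)
  AdjHST-sym (inj₂ (inj₂ e)) = inj₂ (inj₁ e)

  Alternating : List (Fin n) → Fin n → Set
  Alternating C u = ∃₂ λ p q → p ∈ C × q ∈ C × p ≢ q × AdjH k S u p × AdjH k T u q

  two-neighbours⇒alternating : ∀ {C u} → TwoNeighbours (AdjHST k S T) C u → Alternating C u
  two-neighbours⇒alternating (p , q , p∈ , q∈ , p≢q , inj₁ up , inj₂ uq) =
    p , q , p∈ , q∈ , p≢q , up , uq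
  two-neighbours⇒alternating (p , q , p∈ , q∈ , p≢q , inj₂ up , inj₁ uq) =
    q , p , q∈ , p∈ , p≢q ∘ sym , uq , up
  two-neighbours⇒alternating (_ , _ , _ , _ , p≢q , inj₁ up , inj₁ uq) =
    ⊥-elim (p≢q (MS.AdjH-functional up uq))
  two-neighbours⇒alternating (_ , _ , _ , _ , p≢q , inj₂ up , inj₂ uq) =
    ⊥-elim (p≢q (MT.AdjH-functional up uq))

  no-alternating-cycle : ∀ {C X} → X ∈ C → (∀ {u} → u ∈ C → toℕ u ≤ toℕ X) →
                         (∀ {u} → u ∈ C → Alternating C u) → ⊥
  no-alternating-cycle {C} {X} X∈C X-max alternating with alternating X∈C
  ... | a , b , a∈C , b∈C , a≢b , Xa , Xb =
    a≢b (toℕ-injective (≤-antisym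
      (MS.max-partner-least X-max S-partner X,a b∈C (MT.f-snd-small X,b))
      (MT.max-partner-least X-max T-partner X,b a∈C (MS.f-snd-small X,a))))
    where
      X-large : k ≤ toℕ X
      X-large = MS.AdjH-max-large Xa (X-max a∈C)

      X,a : (X , a) ∈ f k S
      X,a = MS.AdjH-large X-large Xa

      X,b : (X , b) ∈ f k T
      X,b = MT.AdjH-large X-large Xb

      S-partner : ∀ {y} → y ∈ C → ∃ λ x → x ∈ C × AdjH k S y x
      S-partner y∈C = let p , _ , p∈C , _ , _ , yp , _ = alternating y∈C in p , p∈C , yp

      T-partner : ∀ {y} → y ∈ C → ∃ λ x → x ∈ C × AdjH k T y x
      T-partner y∈C = let _ , q , _ , q∈C , _ , _ , yq = alternating y∈C in q , q∈C , yq

mainTheorem6 : (n k : ℕ) → 1 ≤ k → k ≤ n → (S T : Subset n) →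
    IsKSubset k S → IsKSubset k T → S ≢ T →
    ¬ HasLongCycle (AdjHST k S T)
mainTheorem6 n k _ _ S T _ _ _ (v , ws , 2≤len , unique , linked) =
  no-alternating-cycle k S T (argmax-∈ toℕ v ws) (argmax-maximal toℕ v ws)
    (two-neighbours⇒alternating k S T ∘
       cycle-neighbours (AdjHST-sym k S T) v ws linked unique 2≤len)
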